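{- Let $N=a+b$ with $a,b\in\mathbb{Z}_{\ge0}$, $G={\operatorname{GL}}_N$, $H={\operatorname{GL}}_a\times{\operatorname{GL}}_b$ block diagonal, $\alpha=(n_1,\dots,n_k)$ a composition of $N$ and $P=P_\alpha$. Then the map $T\mapsto\sigma_T(P)=\sigma_TP\sigma_T^{ -1}$ is a bijection from $\mathcal{T}^\alpha_{a,b}$ to $\mathcal{F}^\alpha_{a,b}$.
   Context: $P_\alpha$ is the standard parabolic of block upper triangular matrices with diagonal blocks of sizes $n_1,\dots,n_k$. Permutations $\sigma\in S_N$ are identified with permutation matrices (Weyl elements). $P_0^H=P_0\cap H$ with $P_0$ the upper triangular Borel of $G$. $\mathcal{F}^\alpha_{a,b}$ is the set of parabolic subgroups of the form $\sigma P_\alpha\sigma^{ -1}$ ($\sigma\in S_N$) that contain $P_0^H$. $\mathcal{T}^\alpha_{a,b}$ is the set of pairs of tuples $(a_1,\dots,a_k)$, $(b_1,\dots,b_k)$ of nonnegative integers with $\sum a_i=a$, $\sum b_i=b$ and $a_i+b_i=n_i$ for all $i$. For intervals of integers, $I\to J$ means $I=[x,y]$, $J=[y+1,z]$; given a tuple $(m_1,\dots,m_t)$ of nonnegative integers summing to $|I|$, the associated consecutive intervals are $I_1\to\dots\to I_t$ partitioning $I$ with $|I_j|=m_j$. For $T\in\mathcal{T}^\alpha_{a,b}$ let $I_1^A\to I_1^B\to\dots\to I_k^A\to I_k^B$ be the consecutive intervals associated to $[1,N]$ and $(a_1,b_1,\dots,a_k,b_k)$, and $A_1\to\dots\to A_k\to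 B_1\to\dots\to B_k$ those associated to $[1,N]$ and $(a_1,\dots,a_k,b_1,\dots,b_k)$; $\sigma_T\in S_N$ is the permutation that is order preserving from $I_j^A$ onto $A_j$ and from $I_j^B$ onto $B_j$ for all $j$. -}

module Defs where

open import Level using (Level; _⊔_) renaming (suc to lsuc)
open import Algebra.Bundles using (CommutativeRing)
open import Data.Nat using (ℕ; zero; suc; _+_; _∸_; _<_; _≤_; _<ᵇ_)
open import Data.Bool using (if_then_else_)
open import Data.Fin using (Fin; toℕ) renaming (zero to fzero; suc to fsuc)
open import Data.Fin.Permutation using (Permutation′; _⟨$⟩ʳ_)
open import Data.Vec using (Vec; []; _∷_; lookup; sum)
open import Data.Product using (Σ; ∃; _×_; _,_)
open import Data.Sum using (_⊎_)
open import Relation.Nullary using (¬_)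
open import Relation.Binary.PropositionalEquality using (_≡_)

record Field (c ℓ : Level) : Set (lsuc (c ⊔ ℓ)) where
  field
    commutativeRing : CommutativeRing c ℓ
  open CommutativeRing commutativeRing public
  field
    1≉0     : ¬ (1# ≈ 0#)
    inverse : ∀ x → ¬ (x ≈ 0#) → Σ Carrier λ y → (x * y) ≈ 1#

-- Combinatorics of compositions (0-indexed positions 0 .. N-1)

pre : ∀ {k} → Vec ℕ k → Fin k → ℕ
pre (x ∷ xs) fzero    = 0
pre (x ∷ xs) (fsuc j) = x + pre xs j

-- blockOf α p = the (0-based) index of the block of α = (n_1,...,n_k)
-- containing position p, i.e. the j with pre α j ≤ p < pre α j + n_j.
blockOf : ∀ {k} → Vec ℕ k → ℕ → ℕ
blockOf []       p = 0
blockOf (n ∷ ns) p = if p <ᵇ n then 0 else suc (blockOf ns (p ∸ n))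

IsComposition : ∀ {k} → ℕ → Vec ℕ k → Set
IsComposition N α = sum α ≡ N × (∀ j → 0 < lookup α j)

InT : ∀ {k} → ℕ → ℕ → Vec ℕ k → Vec ℕ k → Vec ℕ k → Set
InT a b α as bs =
  sum as ≡ a × sum bs ≡ b × (∀ j → lookup as j + lookup bs j ≡ lookup α j)

-- σ is σ_T for T = (as , bs): order preserving from I_j^A onto A_j
-- and from I_j^B onto B_j for all j (0-indexed positions):
--   I_j^A = [pre α j , pre α j + a_j),  A_j = [pre as j , pre as j + a_j)
--   I_j^B = [pre α j + a_j , pre α j + n_j),  B_j = [a + pre bs j , a + pre bs j + b_j)
IsSigmaT : ∀ {k N} → ℕ → Vec ℕ k → Vec ℕ k → Vec ℕ k → Permutation′ N → Set
IsSigmaT {k} {N} a α as bs σ =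
  (∀ (j : Fin k) (p : Fin N) (t : ℕ) → toℕ p ≡ pre α j + t → t < lookup as j →
     toℕ (σ ⟨$⟩ʳ p) ≡ pre as j + t)
  × (∀ (j : Fin k) (p : Fin N) (t : ℕ) → toℕ p ≡ pre α j + lookup as j + t →
     t < lookup bs j → toℕ (σ ⟨$⟩ʳ p) ≡ a + pre bs j + t)

module _ {c ℓ} (F : Field c ℓ) where
  open Field F using (Carrier; _≈_; 0#; 1#) renaming (_+_ to _+F_; _*_ to _*F_)

  Mat : ℕ → Set c
  Mat n = Fin n → Fin n → Carrier

  sumF : ∀ {n} → (Fin n → Carrier) → Carrier
  sumF {zero}  f = 0#
  sumF {suc n} f = f fzero +F sumF (λ i → f (fsuc i))

  _*M_ : ∀ {n} → Mat n → Mat n → Mat n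
  (g *M h) i j = sumF (λ l → g i l *F h l j)

  idM : ∀ {n} → Mat n
  idM i j = if toℕ i Data.Nat.≡ᵇ toℕ j then 1# else 0#

  _≈M_ : ∀ {n} → Mat n → Mat n → Set ℓ
  g ≈M h = ∀ i j → g i j ≈ h i j

  IsGL : ∀ {n} → Mat n → Set (c ⊔ ℓ)
  IsGL g = Σ (Mat _) λ h → (g *M h) ≈M idM × (h *M g) ≈M idM

  SubsetG : ℕ → Set (lsuc (c ⊔ ℓ))
  SubsetG n = Mat n → Set (c ⊔ ℓ)

  _⊆G_ : ∀ {n} → SubsetG n → SubsetG n → Set (c ⊔ ℓ)
  S ⊆G S' = ∀ g → S g → S' g

  _≐G_ : ∀ {n} → SubsetG n → SubsetG n → Set (c ⊔ ℓ)
  S ≐G S' = (S ⊆G S') × (S' ⊆G S)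

  Pα : ∀ {k N} → Vec ℕ k → SubsetG N
  Pα α g = IsGL g × (∀ i j → blockOf α (toℕ j) < blockOf α (toℕ i) → g i j ≈ 0#)

  P0H : ∀ {N} → ℕ → SubsetG N
  P0H a g = IsGL g
    × (∀ i j → toℕ j < toℕ i → g i j ≈ 0#)
    × (∀ i j → ((toℕ i < a × a ≤ toℕ j) ⊎ (a ≤ toℕ i × toℕ j < a)) → g i j ≈ 0#)

  -- conjugate σ S σ⁻¹, where σ is identified with the permutation matrix
  -- M_σ e_j = e_{σ j}.  g ∈ σ S σ⁻¹ iff σ⁻¹ g σ ∈ S, and
  -- (M_σ⁻¹ g M_σ)_{ij} = g_{σ i , σ j}.
  conj : ∀ {N} → Permutation′ N → SubsetG N → SubsetG N
  conj σ S g = S (λ i j → g (σ ⟨$⟩ʳ i) (σ ⟨$⟩ʳ j))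

  InF : ∀ {k N} → ℕ → Vec ℕ k → SubsetG N → Set (c ⊔ ℓ)
  InF a α Q = Σ (Permutation′ _) (λ σ → Q ≐G conj σ (Pα α)) × (P0H a ⊆G Q)

-- Let ℓ_σ x be the index of the block of α containing σ⁻¹ x. Then σ P_α σ⁻¹ consists of the
-- invertible g with g x y = 0 whenever ℓ_σ y < ℓ_σ x. The transvections I + e_xy show that this
-- group determines the preorder "ℓ_σ x ≤ ℓ_σ y", and since every block of α is nonempty the labels
-- form an initial segment of ℕ, so the group determines ℓ_σ itself. It contains P_0^H exactly when
-- ℓ_σ is monotone on [0, a) and on [a, N). For σ = σ_T the labelling reads off the blocks of
-- (a_1, …, a_k) on [0, a) and of (b_1, …, b_k) on [a, N); this gives σ_T(P) ∈ ℱ and injectivity.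
-- Conversely a labelling monotone on both halves is of this form, with a_j and b_j the run lengths
-- of its values, and a_j + b_j = n_j because the number of coordinates labelled j is invariant
-- under σ.

module Submission where

open import Defs
open import Level using (Level)
open import Function using (_∘_; id)
open import Data.Bool using (true; false; T; if_then_else_)
open import Data.Unit using (tt)
open import Data.Fin using (Fin; toℕ; fromℕ<; punchIn) renaming (zero to fzero; suc to fsuc)
open import Data.Fin.Properties using (toℕ-injective; toℕ-fromℕ<; toℕ<n; fromℕ<-toℕ; _≟_; punchInᵢ≢i)
open import Data.Fin.Permutation using (Permutation′; permutation; _⟨$⟩ʳ_; _⟨$⟩ˡ_; inverseˡ; inverseʳ; flip)
open import Data.Nat using (ℕ; zero; suc; _+_; _∸_; _<_; _≤_; _<ᵇ_; _≡ᵇ_; z≤n; s≤s; z<s; _<?_; >-nonZero)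
open import Data.Nat.Properties
  using (+-0-commutativeMonoid; +-assoc; +-identityʳ; +-cancelˡ-<; +-monoʳ-<; +-monoʳ-≤; m≤m+n; m+n∸m≡n;
         m+[n∸m]≡n; ∸-monoˡ-<; ∸-monoˡ-≤; suc-pred; ≡ᵇ⇒≡; ≡⇒≡ᵇ; ≤-refl; ≤-trans; ≤-antisym; <-trans;
         <-≤-trans; ≤-<-trans; <-irrefl; <-asym; <⇒≱; ≮⇒≥; ≰⇒>; ≤∧≢⇒<)
open import Data.Vec using (Vec; []; _∷_; lookup; sum; tabulate)
open import Data.Vec.Properties using (tabulate∘lookup; tabulate-cong)
open import Data.Sum using (_⊎_; inj₁; inj₂; [_,_]′)
import Data.Sum as Sum
open import Data.Product using (Σ; _×_; _,_; proj₁; proj₂)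
open import Relation.Nullary using (¬_; yes; no; contradiction)
open import Relation.Binary.PropositionalEquality
  using (_≡_; _≢_; _≗_; refl; sym; trans; cong; cong₂; subst; subst₂; module ≡-Reasoning)
import Algebra.Properties.CommutativeMonoid.Sum as CommutativeMonoidSum

-- Blocks of a composition

<ᵇ≡true : ∀ {m n} → m < n → (m <ᵇ n) ≡ true
<ᵇ≡true (s≤s z≤n)       = refl
<ᵇ≡true (s≤s (s≤s m<n)) = <ᵇ≡true (s≤s m<n)

≥⇒<ᵇ≡false : ∀ {m n} → n ≤ m → (m <ᵇ n) ≡ false
≥⇒<ᵇ≡false z≤n       = refl
≥⇒<ᵇ≡false (s≤s n≤m) = ≥⇒<ᵇ≡false n≤m

module _ {k} (n : ℕ) (ns : Vec ℕ k) where

  blockOf-< : ∀ {x} → x < n → blockOf (n ∷ ns) x ≡ 0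
  blockOf-< x<n rewrite <ᵇ≡true x<n = refl

  blockOf-≥ : ∀ {x} → n ≤ x → blockOf (n ∷ ns) x ≡ suc (blockOf ns (x ∸ n))
  blockOf-≥ n≤x rewrite ≥⇒<ᵇ≡false n≤x = refl

  blockOf-+ : ∀ x → blockOf (n ∷ ns) (n + x) ≡ suc (blockOf ns x)
  blockOf-+ x rewrite blockOf-≥ (m≤m+n n x) | m+n∸m≡n n x = refl

blockOf-pre : ∀ {k} (v : Vec ℕ k) j {t} → t < lookup v j → blockOf v (pre v j + t) ≡ toℕ j
blockOf-pre (n ∷ ns) fzero    t<n = blockOf-< n ns t<n
blockOf-pre (n ∷ ns) (fsuc j) {t} t< rewrite +-assoc n (pre ns j) t =
  trans (blockOf-+ n ns (pre ns j + t)) (cong suc (blockOf-pre ns j t<))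

blockOf-mono : ∀ {k} (v : Vec ℕ k) {x y} → x ≤ y → blockOf v x ≤ blockOf v y
blockOf-mono []       x≤y = z≤n
blockOf-mono (n ∷ ns) {x} {y} x≤y with x <? n | y <? n
... | yes x<n | _       rewrite blockOf-< n ns x<n = z≤n
... | no x≮n  | yes y<n = contradiction (≤-<-trans x≤y y<n) x≮n
... | no x≮n  | no y≮n
  rewrite blockOf-≥ n ns (≮⇒≥ x≮n) | blockOf-≥ n ns (≮⇒≥ y≮n) =
  s≤s (blockOf-mono ns (∸-monoˡ-≤ n x≤y))

pre+lookup≤sum : ∀ {k} (v : Vec ℕ k) j → pre v j + lookup v j ≤ sum v
pre+lookup≤sum (n ∷ ns) fzero    = m≤m+n n (sum ns)
pre+lookup≤sum (n ∷ ns) (fsuc j) rewrite +-assoc n (pre ns j) (lookup ns j) =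
  +-monoʳ-≤ n (pre+lookup≤sum ns j)

pre+<sum : ∀ {k} (v : Vec ℕ k) j {t} → t < lookup v j → pre v j + t < sum v
pre+<sum v j t< = <-≤-trans (+-monoʳ-< (pre v j) t<) (pre+lookup≤sum v j)

data InBlock {k} (v : Vec ℕ k) (x : ℕ) : Set where
  inBlock : ∀ j t → x ≡ pre v j + t → t < lookup v j → InBlock v x

inBlock? : ∀ {k} (v : Vec ℕ k) x → x < sum v → InBlock v x
inBlock? (n ∷ ns) x x<sum with x <? n
... | yes x<n = inBlock fzero x refl x<n
... | no x≮n with inBlock? ns (x ∸ n)
                   (subst (x ∸ n <_) (m+n∸m≡n n (sum ns)) (∸-monoˡ-< x<sum (≮⇒≥ x≮n)))
...   | inBlock j t x∸n≡ t< = inBlock (fsuc j) t x≡ t<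
  where
  x≡ : x ≡ n + pre ns j + t
  x≡ = begin
    x                  ≡⟨ m+[n∸m]≡n (≮⇒≥ x≮n) ⟨
    n + (x ∸ n)        ≡⟨ cong (n +_) x∸n≡ ⟩
    n + (pre ns j + t) ≡⟨ +-assoc n (pre ns j) t ⟨
    n + pre ns j + t   ∎
    where open ≡-Reasoning

blockOf<length : ∀ {k} (α : Vec ℕ k) {p} → p < sum α → blockOf α p < k
blockOf<length α p< with inBlock? α _ p<
... | inBlock j t refl t< rewrite blockOf-pre α j t< = toℕ<n j

-- Counting labels

δ : ℕ → ℕ → ℕ
δ m j = if m ≡ᵇ j then 1 else 0

count : (ℕ → ℕ) → ℕ → ℕ → ℕ
count f j zero    = 0
count f j (suc n) = δ (f 0) j + count (λ y → f (suc y)) j n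

count-cong : ∀ {f g} j n → (∀ {y} → y < n → f y ≡ g y) → count f j n ≡ count g j n
count-cong j zero    f≡g = refl
count-cong j (suc n) f≡g = cong₂ _+_ (cong (λ m → δ m j) (f≡g z<s)) (count-cong j n (f≡g ∘ s≤s))

count-+ : ∀ f j m n → count f j (m + n) ≡ count f j m + count (λ y → f (m + y)) j n
count-+ f j zero    n = refl
count-+ f j (suc m) n rewrite count-+ (λ y → f (suc y)) j m n = sym (+-assoc (δ (f 0) j) _ _)

count-blockOf : ∀ {k} (v : Vec ℕ k) j → count (blockOf v) (toℕ j) (sum v) ≡ lookup v j
count-blockOf (n ∷ ns) j = begin
  count (blockOf (n ∷ ns)) (toℕ j) (n + sum ns)
    ≡⟨ count-+ (blockOf (n ∷ ns)) (toℕ j) n (sum ns) ⟩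
  count (blockOf (n ∷ ns)) (toℕ j) n + count (λ y → blockOf (n ∷ ns) (n + y)) (toℕ j) (sum ns)
    ≡⟨ cong₂ _+_ (count-cong (toℕ j) n (blockOf-< n ns))
                 (count-cong (toℕ j) (sum ns) (λ {y} _ → blockOf-+ n ns y)) ⟩
  count (λ _ → 0) (toℕ j) n + count (λ y → suc (blockOf ns y)) (toℕ j) (sum ns)
    ≡⟨ split j ⟩
  lookup (n ∷ ns) j ∎
  where
  open ≡-Reasoning
  count-zeros : ∀ m → count (λ _ → 0) 0 m ≡ m
  count-zeros zero    = refl
  count-zeros (suc m) = cong suc (count-zeros m)
  count-zeros-suc : ∀ i m → count (λ _ → 0) (suc i) m ≡ 0
  count-zeros-suc i zero    = refl
  count-zeros-suc i (suc m) = count-zeros-suc i m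
  count-suc-zero : ∀ f m → count (λ y → suc (f y)) 0 m ≡ 0
  count-suc-zero f zero    = refl
  count-suc-zero f (suc m) = count-suc-zero (λ y → f (suc y)) m
  count-suc : ∀ f i m → count (λ y → suc (f y)) (suc i) m ≡ count f i m
  count-suc f i zero    = refl
  count-suc f i (suc m) = cong (δ (f 0) i +_) (count-suc (λ y → f (suc y)) i m)
  split : ∀ j → count (λ _ → 0) (toℕ j) n + count (λ y → suc (blockOf ns y)) (toℕ j) (sum ns)
              ≡ lookup (n ∷ ns) j
  split fzero    rewrite count-zeros n | count-suc-zero (blockOf ns) (sum ns) = +-identityʳ n
  split (fsuc j) rewrite count-zeros-suc (toℕ j) n | count-suc (blockOf ns) (toℕ j) (sum ns) =
    count-blockOf ns j

blockOf-injective : ∀ {k} (u v : Vec ℕ k) {s} → sum u ≡ s → sum v ≡ s →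
  (∀ {y} → y < s → blockOf u y ≡ blockOf v y) → u ≡ v
blockOf-injective u v refl sv≡ u≗v = begin
  u                  ≡⟨ tabulate∘lookup u ⟨
  tabulate (lookup u) ≡⟨ tabulate-cong lookup-u≗v ⟩
  tabulate (lookup v) ≡⟨ tabulate∘lookup v ⟩
  v                  ∎
  where
  open ≡-Reasoning
  lookup-u≗v : ∀ j → lookup u j ≡ lookup v j
  lookup-u≗v j = begin
    lookup u j                          ≡⟨ count-blockOf u j ⟨
    count (blockOf u) (toℕ j) (sum u)   ≡⟨ count-cong (toℕ j) (sum u) u≗v ⟩
    count (blockOf v) (toℕ j) (sum u)   ≡⟨ cong (count (blockOf v) (toℕ j)) sv≡ ⟨
    count (blockOf v) (toℕ j) (sum v)   ≡⟨ count-blockOf v j ⟩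
    lookup v j                          ∎

count-permute : ∀ {n} (σ : Permutation′ n) (f g : ℕ → ℕ) j →
  (∀ p → f (toℕ (σ ⟨$⟩ʳ p)) ≡ g (toℕ p)) → count f j n ≡ count g j n
count-permute {n} σ f g j f∘σ≗g = begin
  count f j n                              ≡⟨ count-toℕ n f ⟩
  ∑.sum {n} (λ x → δ (f (toℕ x)) j)          ≡⟨ ∑.∑-permute (λ x → δ (f (toℕ x)) j) σ ⟩
  ∑.sum {n} (λ p → δ (f (toℕ (σ ⟨$⟩ʳ p))) j) ≡⟨ ∑.sum-cong-≗ {n} (λ p → cong (λ m → δ m j) (f∘σ≗g p)) ⟩
  ∑.sum {n} (λ p → δ (g (toℕ p)) j)          ≡⟨ count-toℕ n g ⟨
  count g j n                              ∎
  where
  open ≡-Reasoning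
  module ∑ = CommutativeMonoidSum +-0-commutativeMonoid
  count-toℕ : ∀ m (h : ℕ → ℕ) → count h j m ≡ ∑.sum {m} (λ x → δ (h (toℕ x)) j)
  count-toℕ zero    h = refl
  count-toℕ (suc m) h = cong (δ (h 0) j +_) (count-toℕ m (h ∘ suc))

-- Run lengths of a monotone labelling

MonotoneBelow : ℕ → (ℕ → ℕ) → Set
MonotoneBelow a h = ∀ {x y} → x ≤ y → y < a → h x ≤ h y

leadingZeros : (ℕ → ℕ) → ℕ → ℕ
leadingZeros h zero    = 0
leadingZeros h (suc a) with h 0
... | zero  = suc (leadingZeros (λ y → h (suc y)) a)
... | suc _ = 0

leadingZeros≤ : ∀ h a → leadingZeros h a ≤ a
leadingZeros≤ h zero    = z≤n
leadingZeros≤ h (suc a) with h 0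
... | zero  = s≤s (leadingZeros≤ (λ y → h (suc y)) a)
... | suc _ = z≤n

<leadingZeros⇒≡0 : ∀ h a {x} → x < leadingZeros h a → h x ≡ 0
<leadingZeros⇒≡0 h (suc a) {x} x< with h 0 in h0≡
<leadingZeros⇒≡0 h (suc a) {zero}  x<       | zero = h0≡
<leadingZeros⇒≡0 h (suc a) {suc x} (s≤s x<) | zero = <leadingZeros⇒≡0 (λ y → h (suc y)) a x<

leadingZeros≤⇒>0 : ∀ h a → MonotoneBelow a h → ∀ {x} → leadingZeros h a ≤ x → x < a → 0 < h x
leadingZeros≤⇒>0 h (suc a) mono {x} ≤x x<a with h 0 in h0≡
leadingZeros≤⇒>0 h (suc a) mono {suc x} (s≤s ≤x) (s≤s x<a) | zero =
  leadingZeros≤⇒>0 (λ y → h (suc y)) a (λ x≤y y<a → mono (s≤s x≤y) (s≤s y<a)) ≤x x<a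
... | suc _ = ≤-trans (subst (0 <_) (sym h0≡) z<s) (mono z≤n x<a)

residual : (ℕ → ℕ) → ℕ → ℕ → ℕ
residual h a y = h (leadingZeros h a + y) ∸ 1

module _ (h : ℕ → ℕ) (a : ℕ) (mono : MonotoneBelow a h) where

  private
    m = leadingZeros h a

    shift< : ∀ {y} → y < a ∸ m → m + y < a
    shift< {y} y< = subst (m + y <_) (m+[n∸m]≡n (leadingZeros≤ h a)) (+-monoʳ-< m y<)

  residual-mono : MonotoneBelow (a ∸ m) (residual h a)
  residual-mono x≤y y< = ∸-monoˡ-≤ 1 (mono (+-monoʳ-≤ m x≤y) (shift< y<))

  residual-bound : ∀ {k} → (∀ {y} → y < a → h y < suc k) → ∀ {y} → y < a ∸ m → residual h a y < k
  residual-bound bound {y} y< with h (m + y) | leadingZeros≤⇒>0 h a mono (m≤m+n m y) (shift< y<)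
                                | bound (shift< y<)
  ... | suc z | _ | s≤s z<k = z<k

runLengths : (k : ℕ) → (ℕ → ℕ) → ℕ → Vec ℕ k
runLengths zero    h a = []
runLengths (suc k) h a = leadingZeros h a ∷ runLengths k (residual h a) (a ∸ leadingZeros h a)

sum-runLengths : ∀ k h a → MonotoneBelow a h → (∀ {y} → y < a → h y < k) →
  sum (runLengths k h a) ≡ a
sum-runLengths zero    h zero    mono bound = refl
sum-runLengths zero    h (suc a) mono bound = contradiction (bound z<s) λ ()
sum-runLengths (suc k) h a       mono bound =
  trans (cong (leadingZeros h a +_)
           (sum-runLengths k (residual h a) _ (residual-mono h a mono) (residual-bound h a mono bound)))
        (m+[n∸m]≡n (leadingZeros≤ h a))

blockOf-runLengths : ∀ k h a → MonotoneBelow a h → (∀ {y} → y < a → h y < k) →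
  ∀ {y} → y < a → blockOf (runLengths k h a) y ≡ h y
blockOf-runLengths zero    h a mono bound y<a = contradiction (bound y<a) λ ()
blockOf-runLengths (suc k) h a mono bound {y} y<a with y <? leadingZeros h a
... | yes y<m = trans (blockOf-< (leadingZeros h a) (runLengths k (residual h a) _) y<m)
                      (sym (<leadingZeros⇒≡0 h a y<m))
... | no y≮m = begin
  blockOf (m ∷ rest) y                  ≡⟨ blockOf-≥ m rest m≤y ⟩
  suc (blockOf rest (y ∸ m))            ≡⟨ cong suc (blockOf-runLengths k (residual h a) (a ∸ m)
                                               (residual-mono h a mono) (residual-bound h a mono bound)
                                               (∸-monoˡ-< y<a m≤y)) ⟩
  suc (h (m + (y ∸ m)) ∸ 1)             ≡⟨ cong (λ z → suc (h z ∸ 1)) (m+[n∸m]≡n m≤y) ⟩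
  suc (h y ∸ 1)                         ≡⟨ suc-pred (h y) ⦃ >-nonZero h-y>0 ⦄ ⟩
  h y                                   ∎
  where
  open ≡-Reasoning
  m = leadingZeros h a
  rest = runLengths k (residual h a) (a ∸ m)
  m≤y = ≮⇒≥ y≮m
  h-y>0 = leadingZeros≤⇒>0 h a mono m≤y y<a

lookup-runLengths : ∀ k h a → MonotoneBelow a h → (∀ {y} → y < a → h y < k) →
  ∀ j → lookup (runLengths k h a) j ≡ count h (toℕ j) a
lookup-runLengths k h a mono bound j = begin
  lookup runs j                           ≡⟨ count-blockOf runs j ⟨
  count (blockOf runs) (toℕ j) (sum runs) ≡⟨ cong (count (blockOf runs) (toℕ j))
                                                  (sum-runLengths k h a mono bound) ⟩
  count (blockOf runs) (toℕ j) a          ≡⟨ count-cong (toℕ j) a (blockOf-runLengths k h a mono bound) ⟩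
  count h (toℕ j) a                       ∎
  where
  open ≡-Reasoning
  runs = runLengths k h a

-- Labellings of coordinates

blockLabel : ∀ {k n} → Vec ℕ k → Permutation′ n → Fin n → ℕ
blockLabel α σ x = blockOf α (toℕ (σ ⟨$⟩ˡ x))

ImageDownClosed : ∀ {A : Set} → (A → ℕ) → Set
ImageDownClosed {A} ℓ = ∀ x {j} → j < ℓ x → Σ A λ w → ℓ w ≡ j

labelling-unique : ∀ {A : Set} (ℓ ℓ′ : A → ℕ) → ImageDownClosed ℓ → ImageDownClosed ℓ′ →
  (∀ x y → ℓ x ≤ ℓ y → ℓ′ x ≤ ℓ′ y) → (∀ x y → ℓ′ x ≤ ℓ′ y → ℓ x ≤ ℓ y) → ∀ x → ℓ x ≡ ℓ′ x
labelling-unique ℓ ℓ′ closed closed′ ℓ⇒ℓ′ ℓ′⇒ℓ x =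
  ≤-antisym (dominated ℓ ℓ′ closed ℓ′⇒ℓ refl) (dominated ℓ′ ℓ closed′ ℓ⇒ℓ′ refl)
  where
  dominated : ∀ {A : Set} (ℓ ℓ′ : A → ℕ) → ImageDownClosed ℓ → (∀ x y → ℓ′ x ≤ ℓ′ y → ℓ x ≤ ℓ y) →
    ∀ {j x} → ℓ x ≡ j → j ≤ ℓ′ x
  dominated ℓ ℓ′ closed ℓ′⇒ℓ {zero}  ℓx≡j = z≤n
  dominated ℓ ℓ′ closed ℓ′⇒ℓ {suc j} {x} ℓx≡j with closed x (subst (j <_) (sym ℓx≡j) ≤-refl)
  ... | w , ℓw≡j = <-≤-trans (s≤s (dominated ℓ ℓ′ closed ℓ′⇒ℓ ℓw≡j)) (≰⇒> λ ℓ′x≤ℓ′w →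
                     <⇒≱ (subst₂ _<_ (sym ℓw≡j) (sym ℓx≡j) ≤-refl) (ℓ′⇒ℓ x w ℓ′x≤ℓ′w))

blockLabel-downClosed : ∀ {k} (α : Vec ℕ k) {n} (σ : Permutation′ n) → sum α ≡ n →
  (∀ j → 0 < lookup α j) → ImageDownClosed (blockLabel α σ)
blockLabel-downClosed α σ refl positive x {j} j< = σ ⟨$⟩ʳ fromℕ< start<n , (begin
  blockOf α (toℕ (σ ⟨$⟩ˡ (σ ⟨$⟩ʳ fromℕ< start<n))) ≡⟨ cong (blockOf α ∘ toℕ) (inverseˡ σ) ⟩
  blockOf α (toℕ (fromℕ< start<n))                 ≡⟨ cong (blockOf α) (toℕ-fromℕ< start<n) ⟩
  blockOf α (pre α j′ + 0)                         ≡⟨ blockOf-pre α j′ (positive j′) ⟩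
  toℕ j′                                           ≡⟨ toℕ-fromℕ< j<k ⟩
  j                                                ∎)
  where
  open ≡-Reasoning
  j<k = <-trans j< (blockOf<length α (toℕ<n (σ ⟨$⟩ˡ x)))
  j′ = fromℕ< j<k
  start<n = pre+<sum α j′ (positive j′)

MonotoneOnHalves : ∀ {n} → ℕ → (Fin n → ℕ) → Set
MonotoneOnHalves a ℓ = ∀ x y → toℕ x ≤ toℕ y → toℕ y < a ⊎ a ≤ toℕ x → ℓ x ≤ ℓ y

extendℕ : ∀ {n} → (Fin n → ℕ) → ℕ → ℕ
extendℕ {n} ℓ y with y <? n
... | yes y<n = ℓ (fromℕ< y<n)
... | no _    = 0

extendℕ-fromℕ< : ∀ {n} (ℓ : Fin n → ℕ) {y} (y<n : y < n) → extendℕ ℓ y ≡ ℓ (fromℕ< y<n)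
extendℕ-fromℕ< {n} ℓ {y} y<n with y <? n
... | yes _   = refl
... | no y≮n  = contradiction y<n y≮n

extendℕ-toℕ : ∀ {n} (ℓ : Fin n → ℕ) x → extendℕ ℓ (toℕ x) ≡ ℓ x
extendℕ-toℕ ℓ x = trans (extendℕ-fromℕ< ℓ (toℕ<n x)) (cong ℓ (fromℕ<-toℕ x (toℕ<n x)))

module _ a {b} {ℓ : Fin (a + b) → ℕ} (mono : MonotoneOnHalves a ℓ) where

  private
    mono′ : ∀ {x y} (x< : x < a + b) (y< : y < a + b) → x ≤ y → y < a ⊎ a ≤ x →
      extendℕ ℓ x ≤ extendℕ ℓ y
    mono′ x< y< x≤y half =
      subst₂ _≤_ (sym (extendℕ-fromℕ< ℓ x<)) (sym (extendℕ-fromℕ< ℓ y<))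
        (mono _ _ (subst₂ _≤_ (sym (toℕ-fromℕ< x<)) (sym (toℕ-fromℕ< y<)) x≤y)
          (Sum.map (subst (_< a) (sym (toℕ-fromℕ< y<))) (subst (a ≤_) (sym (toℕ-fromℕ< x<))) half))

  MonotoneOnHalves⇒lower : MonotoneBelow a (extendℕ ℓ)
  MonotoneOnHalves⇒lower x≤y y<a =
    mono′ (<-≤-trans (≤-<-trans x≤y y<a) (m≤m+n a b)) (<-≤-trans y<a (m≤m+n a b)) x≤y (inj₁ y<a)

  MonotoneOnHalves⇒upper : MonotoneBelow b (extendℕ ℓ ∘ (a +_))
  MonotoneOnHalves⇒upper x≤y y<b =
    mono′ (+-monoʳ-< a (≤-<-trans x≤y y<b)) (+-monoʳ-< a y<b) (+-monoʳ-≤ a x≤y) (inj₂ (m≤m+n a _))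

module _ {k} (α : Vec ℕ k) {n} (σ : Permutation′ n) (sum-α : sum α ≡ n) where

  extendℕ-blockLabel< : ∀ {y} → y < n → extendℕ (blockLabel α σ) y < k
  extendℕ-blockLabel< y<n rewrite extendℕ-fromℕ< (blockLabel α σ) y<n =
    blockOf<length α (subst (_ <_) (sym sum-α) (toℕ<n _))

  count-blockLabel : ∀ j → count (extendℕ (blockLabel α σ)) (toℕ j) n ≡ lookup α j
  count-blockLabel j = begin
    count (extendℕ (blockLabel α σ)) (toℕ j) n  ≡⟨ count-permute σ _ (blockOf α) (toℕ j) relabel ⟩
    count (blockOf α) (toℕ j) n                 ≡⟨ cong (count (blockOf α) (toℕ j)) sum-α ⟨
    count (blockOf α) (toℕ j) (sum α)           ≡⟨ count-blockOf α j ⟩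
    lookup α j                                  ∎
    where
    open ≡-Reasoning
    relabel : ∀ p → extendℕ (blockLabel α σ) (toℕ (σ ⟨$⟩ʳ p)) ≡ blockOf α (toℕ p)
    relabel p = trans (extendℕ-toℕ (blockLabel α σ) (σ ⟨$⟩ʳ p)) (cong (blockOf α ∘ toℕ) (inverseˡ σ))

-- The layout A_1 → ⋯ → A_k → B_1 → ⋯ → B_k

Rows : ∀ {k} → Vec ℕ k → Vec ℕ k → Vec ℕ k → Set
Rows α as bs = ∀ j → lookup as j + lookup bs j ≡ lookup α j

module _ (a : ℕ) {k} (as bs : Vec ℕ k) where

  targetBlock : ℕ → ℕ
  targetBlock q = if q <ᵇ a then blockOf as q else blockOf bs (q ∸ a)

  targetBlock-< : ∀ {q} → q < a → targetBlock q ≡ blockOf as q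
  targetBlock-< q<a rewrite <ᵇ≡true q<a = refl

  targetBlock-≥ : ∀ {q} → a ≤ q → targetBlock q ≡ blockOf bs (q ∸ a)
  targetBlock-≥ a≤q rewrite ≥⇒<ᵇ≡false a≤q = refl

  targetBlock-+ : ∀ q → targetBlock (a + q) ≡ blockOf bs q
  targetBlock-+ q = trans (targetBlock-≥ (m≤m+n a q)) (cong (blockOf bs) (m+n∸m≡n a q))

  targetBlock-mono : ∀ {x y} → x ≤ y → y < a ⊎ a ≤ x → targetBlock x ≤ targetBlock y
  targetBlock-mono x≤y (inj₁ y<a) rewrite targetBlock-< (≤-<-trans x≤y y<a) | targetBlock-< y<a =
    blockOf-mono as x≤y
  targetBlock-mono x≤y (inj₂ a≤x) rewrite targetBlock-≥ a≤x | targetBlock-≥ (≤-trans a≤x x≤y) =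
    blockOf-mono bs (∸-monoˡ-≤ a x≤y)

targetBlock-injective : ∀ a {b k} (as bs as′ bs′ : Vec ℕ k) →
  sum as ≡ a → sum bs ≡ b → sum as′ ≡ a → sum bs′ ≡ b →
  (∀ {y} → y < a + b → targetBlock a as bs y ≡ targetBlock a as′ bs′ y) → as ≡ as′ × bs ≡ bs′
targetBlock-injective a {b} as bs as′ bs′ sum-as sum-bs sum-as′ sum-bs′ same =
  blockOf-injective as as′ sum-as sum-as′ (λ y<a →
    trans (sym (targetBlock-< a as bs y<a))
          (trans (same (<-≤-trans y<a (m≤m+n a b))) (targetBlock-< a as′ bs′ y<a))) ,
  blockOf-injective bs bs′ sum-bs sum-bs′ (λ {y} y<b →
    trans (sym (targetBlock-+ a as bs y))
          (trans (same (+-monoʳ-< a y<b)) (targetBlock-+ a as′ bs′ y)))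

targetBlock-surjective : ∀ {k} (α : Vec ℕ k) a b (h : ℕ → ℕ) →
  MonotoneBelow a h → MonotoneBelow b (h ∘ (a +_)) → (∀ {y} → y < a + b → h y < k) →
  (∀ j → count h (toℕ j) (a + b) ≡ lookup α j) →
  Σ (Vec ℕ k) λ as → Σ (Vec ℕ k) λ bs →
    InT a b α as bs × (∀ {y} → y < a + b → targetBlock a as bs y ≡ h y)
targetBlock-surjective {k} α a b h monoA monoB bound counts =
  as , bs , (sum-as , sum-bs , rows) , realises
  where
  boundA : ∀ {y} → y < a → h y < k
  boundA y<a = bound (<-≤-trans y<a (m≤m+n a b))
  boundB : ∀ {y} → y < b → h (a + y) < k
  boundB y<b = bound (+-monoʳ-< a y<b)
  as = runLengths k h a
  bs = runLengths k (h ∘ (a +_)) b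
  sum-as : sum as ≡ a
  sum-as = sum-runLengths k h a monoA boundA
  sum-bs : sum bs ≡ b
  sum-bs = sum-runLengths k (h ∘ (a +_)) b monoB boundB
  rows : Rows α as bs
  rows j = begin
    lookup as j + lookup bs j                        ≡⟨ cong₂ _+_ (lookup-runLengths k h a monoA boundA j)
                                                         (lookup-runLengths k (h ∘ (a +_)) b monoB boundB j) ⟩
    count h (toℕ j) a + count (h ∘ (a +_)) (toℕ j) b ≡⟨ count-+ h (toℕ j) a b ⟨
    count h (toℕ j) (a + b)                          ≡⟨ counts j ⟩
    lookup α j                                       ∎
    where open ≡-Reasoning
  realises : ∀ {y} → y < a + b → targetBlock a as bs y ≡ h y
  realises {y} y< with y <? a
  ... | yes y<a = trans (targetBlock-< a as bs y<a) (blockOf-runLengths k h a monoA boundA y<a)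
  ... | no y≮a  = begin
    targetBlock a as bs y  ≡⟨ targetBlock-≥ a as bs (≮⇒≥ y≮a) ⟩
    blockOf bs (y ∸ a)     ≡⟨ blockOf-runLengths k (h ∘ (a +_)) b monoB boundB
                                (subst (y ∸ a <_) (m+n∸m≡n a b) (∸-monoˡ-< y< (≮⇒≥ y≮a))) ⟩
    h (a + (y ∸ a))        ≡⟨ cong h (m+[n∸m]≡n (≮⇒≥ y≮a)) ⟩
    h y                    ∎
    where open ≡-Reasoning

-- σ_T factors through [0, a) ⊎ [0, b): split α as bs is the first map, merge α as bs its inverse.
split : ∀ {k} → Vec ℕ k → Vec ℕ k → Vec ℕ k → ℕ → ℕ ⊎ ℕ
split []      []       []       p = inj₁ p
split (n ∷ α) (x ∷ as) (y ∷ bs) p =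
  if p <ᵇ x then inj₁ p
  else if p <ᵇ n then inj₂ (p ∸ x)
  else Sum.map (x +_) (y +_) (split α as bs (p ∸ n))

merge : ∀ {k} → Vec ℕ k → Vec ℕ k → Vec ℕ k → ℕ ⊎ ℕ → ℕ
merge []      []       []       _        = 0
merge (n ∷ α) (x ∷ as) (y ∷ bs) (inj₁ q) = if q <ᵇ x then q else n + merge α as bs (inj₁ (q ∸ x))
merge (n ∷ α) (x ∷ as) (y ∷ bs) (inj₂ q) = if q <ᵇ y then x + q else n + merge α as bs (inj₂ (q ∸ y))

split-A : ∀ {k} (α as bs : Vec ℕ k) → Rows α as bs → ∀ j {t} → t < lookup as j →
  split α as bs (pre α j + t) ≡ inj₁ (pre as j + t)
split-A (n ∷ α) (x ∷ as) (y ∷ bs) rows fzero    t<x rewrite <ᵇ≡true t<x = refl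
split-A (n ∷ α) (x ∷ as) (y ∷ bs) rows (fsuc j) {t} t<
  rewrite +-assoc n (pre α j) t
        | ≥⇒<ᵇ≡false (≤-trans (subst (x ≤_) (rows fzero) (m≤m+n x y)) (m≤m+n n (pre α j + t)))
        | ≥⇒<ᵇ≡false (m≤m+n n (pre α j + t))
        | m+n∸m≡n n (pre α j + t)
        | split-A α as bs (rows ∘ fsuc) j t<
  = cong inj₁ (sym (+-assoc x (pre as j) t))

split-B : ∀ {k} (α as bs : Vec ℕ k) → Rows α as bs → ∀ j {t} → t < lookup bs j →
  split α as bs (pre α j + lookup as j + t) ≡ inj₂ (pre bs j + t)
split-B (n ∷ α) (x ∷ as) (y ∷ bs) rows fzero    {t} t<y
  rewrite ≥⇒<ᵇ≡false (m≤m+n x t)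
        | <ᵇ≡true (subst (x + t <_) (rows fzero) (+-monoʳ-< x t<y))
        | m+n∸m≡n x t
  = refl
split-B (n ∷ α) (x ∷ as) (y ∷ bs) rows (fsuc j) {t} t<
  rewrite +-assoc n (pre α j) (lookup as j) | +-assoc n (pre α j + lookup as j) t
        | ≥⇒<ᵇ≡false (≤-trans (subst (x ≤_) (rows fzero) (m≤m+n x y))
                              (m≤m+n n (pre α j + lookup as j + t)))
        | ≥⇒<ᵇ≡false (m≤m+n n (pre α j + lookup as j + t))
        | m+n∸m≡n n (pre α j + lookup as j + t)
        | split-B α as bs (rows ∘ fsuc) j t<
  = cong inj₂ (sym (+-assoc y (pre bs j) t))

merge-A : ∀ {k} (α as bs : Vec ℕ k) j {t} → t < lookup as j →
  merge α as bs (inj₁ (pre as j + t)) ≡ pre α j + t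
merge-A (n ∷ α) (x ∷ as) (y ∷ bs) fzero    t<x rewrite <ᵇ≡true t<x = refl
merge-A (n ∷ α) (x ∷ as) (y ∷ bs) (fsuc j) {t} t<
  rewrite +-assoc x (pre as j) t
        | ≥⇒<ᵇ≡false (m≤m+n x (pre as j + t))
        | m+n∸m≡n x (pre as j + t)
        | merge-A α as bs j t<
  = sym (+-assoc n (pre α j) t)

merge-B : ∀ {k} (α as bs : Vec ℕ k) j {t} → t < lookup bs j →
  merge α as bs (inj₂ (pre bs j + t)) ≡ pre α j + lookup as j + t
merge-B (n ∷ α) (x ∷ as) (y ∷ bs) fzero    t<y rewrite <ᵇ≡true t<y = refl
merge-B (n ∷ α) (x ∷ as) (y ∷ bs) (fsuc j) {t} t<
  rewrite +-assoc y (pre bs j) t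
        | ≥⇒<ᵇ≡false (m≤m+n y (pre bs j + t))
        | m+n∸m≡n y (pre bs j + t)
        | merge-B α as bs j t<
  = trans (sym (+-assoc n (pre α j + lookup as j) t))
          (cong (_+ t) (sym (+-assoc n (pre α j) (lookup as j))))

module _ {n} (f g : ℕ → ℕ) (f< : ∀ {x} → x < n → f x < n) (g< : ∀ {x} → x < n → g x < n)
         (g∘f : ∀ {x} → x < n → g (f x) ≡ x) (f∘g : ∀ {x} → x < n → f (g x) ≡ x) where

  permutationℕ : Permutation′ n
  permutationℕ = permutation (λ p → fromℕ< (f< (toℕ<n p))) (λ q → fromℕ< (g< (toℕ<n q)))
    (λ q → toℕ-injective (trans (toℕ-fromℕ< _)
             (trans (cong f (toℕ-fromℕ< _)) (f∘g (toℕ<n q)))))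
    (λ p → toℕ-injective (trans (toℕ-fromℕ< _)
             (trans (cong g (toℕ-fromℕ< _)) (g∘f (toℕ<n p)))))

  toℕ-permutationℕ : ∀ p → toℕ (permutationℕ ⟨$⟩ʳ p) ≡ f (toℕ p)
  toℕ-permutationℕ p = toℕ-fromℕ< _

module SigmaT {k} (a b : ℕ) (α as bs : Vec ℕ k) (sum-α : sum α ≡ a + b) (T : InT a b α as bs) where

  private
    sum-as : sum as ≡ a
    sum-as = proj₁ T
    sum-bs : sum bs ≡ b
    sum-bs = proj₁ (proj₂ T)
    rows : Rows α as bs
    rows = proj₂ (proj₂ T)

    as≤α : ∀ j → lookup as j ≤ lookup α j
    as≤α j = subst (lookup as j ≤_) (rows j) (m≤m+n _ _)

    A< : ∀ j {t} → t < lookup as j → pre as j + t < a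
    A< j t< = subst (_ <_) sum-as (pre+<sum as j t<)

    B< : ∀ j {t} → t < lookup bs j → pre bs j + t < b
    B< j t< = subst (_ <_) sum-bs (pre+<sum bs j t<)

    data Source (p : ℕ) : Set where
      fromA : ∀ j t → p ≡ pre α j + t → t < lookup as j → Source p
      fromB : ∀ j t → p ≡ pre α j + lookup as j + t → t < lookup bs j → Source p

    source : ∀ {p} → p < a + b → Source p
    source {p} p< with inBlock? α p (subst (p <_) (sym sum-α) p<)
    ... | inBlock j t p≡ t< with t <? lookup as j
    ...   | yes t<as = fromA j t p≡ t<as
    ...   | no t≮as = fromB j (t ∸ lookup as j) p≡′
                        (+-cancelˡ-< (lookup as j) _ _ (subst₂ _<_ t≡ (sym (rows j)) t<))
      where
      t≡ : t ≡ lookup as j + (t ∸ lookup as j)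
      t≡ = sym (m+[n∸m]≡n (≮⇒≥ t≮as))
      p≡′ : p ≡ pre α j + lookup as j + (t ∸ lookup as j)
      p≡′ = trans p≡ (trans (cong (pre α j +_) t≡) (sym (+-assoc (pre α j) _ _)))

    data Target (q : ℕ) : Set where
      toA : ∀ j t → q ≡ pre as j + t → t < lookup as j → Target q
      toB : ∀ j t → q ≡ a + (pre bs j + t) → t < lookup bs j → Target q

    target : ∀ {q} → q < a + b → Target q
    target {q} q< with q <? a
    ... | yes q<a with inBlock? as q (subst (q <_) (sym sum-as) q<a)
    ...   | inBlock j t q≡ t< = toA j t q≡ t<
    target {q} q< | no q≮a with inBlock? bs (q ∸ a) (subst (q ∸ a <_) (trans (m+n∸m≡n a b) (sym sum-bs))
                                                          (∸-monoˡ-< q< (≮⇒≥ q≮a)))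
    ...   | inBlock j t q∸a≡ t< = toB j t (trans (sym (m+[n∸m]≡n (≮⇒≥ q≮a))) (cong (a +_) q∸a≡)) t<

    forward : ℕ → ℕ
    forward p = [ id , a +_ ]′ (split α as bs p)

    backward : ℕ → ℕ
    backward q = merge α as bs (if q <ᵇ a then inj₁ q else inj₂ (q ∸ a))

    forward-A : ∀ j {t} → t < lookup as j → forward (pre α j + t) ≡ pre as j + t
    forward-A j t< rewrite split-A α as bs rows j t< = refl

    forward-B : ∀ j {t} → t < lookup bs j → forward (pre α j + lookup as j + t) ≡ a + (pre bs j + t)
    forward-B j t< rewrite split-B α as bs rows j t< = refl

    backward-A : ∀ j {t} → t < lookup as j → backward (pre as j + t) ≡ pre α j + t
    backward-A j t< rewrite <ᵇ≡true (A< j t<) = merge-A α as bs j t<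

    backward-B : ∀ j {t} → t < lookup bs j → backward (a + (pre bs j + t)) ≡ pre α j + lookup as j + t
    backward-B j {t} t< rewrite ≥⇒<ᵇ≡false (m≤m+n a (pre bs j + t)) | m+n∸m≡n a (pre bs j + t) =
      merge-B α as bs j t<

    forward< : ∀ {p} → p < a + b → forward p < a + b
    forward< p< with source p<
    ... | fromA j t refl t< rewrite forward-A j t< = <-≤-trans (A< j t<) (m≤m+n a b)
    ... | fromB j t refl t< rewrite forward-B j t< = +-monoʳ-< a (B< j t<)

    backward< : ∀ {q} → q < a + b → backward q < a + b
    backward< q< with target q<
    ... | toA j t refl t< rewrite backward-A j t< =
      subst (pre α j + t <_) sum-α (pre+<sum α j (<-≤-trans t< (as≤α j)))
    ... | toB j t refl t< rewrite backward-B j t< | +-assoc (pre α j) (lookup as j) t =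
      subst (pre α j + (lookup as j + t) <_) sum-α
        (pre+<sum α j (subst (lookup as j + t <_) (rows j) (+-monoʳ-< (lookup as j) t<)))

    backward∘forward : ∀ {p} → p < a + b → backward (forward p) ≡ p
    backward∘forward p< with source p<
    ... | fromA j t refl t< rewrite forward-A j t< = backward-A j t<
    ... | fromB j t refl t< rewrite forward-B j t< = backward-B j t<

    forward∘backward : ∀ {q} → q < a + b → forward (backward q) ≡ q
    forward∘backward q< with target q<
    ... | toA j t refl t< rewrite backward-A j t< = forward-A j t<
    ... | toB j t refl t< rewrite backward-B j t< = forward-B j t<

  σT : Permutation′ (a + b)
  σT = permutationℕ forward backward forward< backward< backward∘forward forward∘backward

  private
    toℕ-σT : ∀ p → toℕ (σT ⟨$⟩ʳ p) ≡ forward (toℕ p)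
    toℕ-σT = toℕ-permutationℕ forward backward forward< backward< backward∘forward forward∘backward

  σT-isSigmaT : IsSigmaT a α as bs σT
  σT-isSigmaT =
    (λ j p t p≡ t< → trans (toℕ-σT p) (trans (cong forward p≡) (forward-A j t<))) ,
    (λ j p t p≡ t< → trans (toℕ-σT p)
                       (trans (cong forward p≡) (trans (forward-B j t<) (sym (+-assoc a (pre bs j) t)))))

  IsSigmaT⇒targetBlock : ∀ σ → IsSigmaT a α as bs σ → ∀ p →
    targetBlock a as bs (toℕ (σ ⟨$⟩ʳ p)) ≡ blockOf α (toℕ p)
  IsSigmaT⇒targetBlock σ (onA , onB) p with source (toℕ<n p)
  ... | fromA j t p≡ t< = begin
    targetBlock a as bs (toℕ (σ ⟨$⟩ʳ p)) ≡⟨ cong (targetBlock a as bs) (onA j p t p≡ t<) ⟩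
    targetBlock a as bs (pre as j + t)   ≡⟨ targetBlock-< a as bs (A< j t<) ⟩
    blockOf as (pre as j + t)            ≡⟨ blockOf-pre as j t< ⟩
    toℕ j                                ≡⟨ blockOf-pre α j (<-≤-trans t< (as≤α j)) ⟨
    blockOf α (pre α j + t)              ≡⟨ cong (blockOf α) p≡ ⟨
    blockOf α (toℕ p)                    ∎
    where open ≡-Reasoning
  ... | fromB j t p≡ t< = begin
    targetBlock a as bs (toℕ (σ ⟨$⟩ʳ p))     ≡⟨ cong (targetBlock a as bs)
                                                   (trans (onB j p t p≡ t<) (+-assoc a (pre bs j) t)) ⟩
    targetBlock a as bs (a + (pre bs j + t)) ≡⟨ targetBlock-+ a as bs (pre bs j + t) ⟩
    blockOf bs (pre bs j + t)                ≡⟨ blockOf-pre bs j t< ⟩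
    toℕ j                                    ≡⟨ blockOf-pre α j (subst (lookup as j + t <_) (rows j)
                                                                   (+-monoʳ-< _ t<)) ⟨
    blockOf α (pre α j + (lookup as j + t))  ≡⟨ cong (blockOf α) (trans p≡ (+-assoc (pre α j) _ t)) ⟨
    blockOf α (toℕ p)                        ∎
    where open ≡-Reasoning

  IsSigmaT⇒blockLabel : ∀ σ → IsSigmaT a α as bs σ → ∀ x → blockLabel α σ x ≡ targetBlock a as bs (toℕ x)
  IsSigmaT⇒blockLabel σ S x =
    sym (trans (cong (targetBlock a as bs ∘ toℕ) (sym (inverseʳ σ)))
               (IsSigmaT⇒targetBlock σ S (σ ⟨$⟩ˡ x)))

-- Matrices and parabolic subgroups

module _ {c r} (F : Field c r) where

  private module R = Field F
  open R using (Carrier; _≈_; 0#; 1#; -_) renaming (_+_ to _+F_; _*_ to _*F_)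
  open CommutativeMonoidSum R.+-commutativeMonoid
    using (sum-cong-≋; sum-replicate-zero; sum-remove; ∑-distrib-+; ∑-permute) renaming (sum to ∑)
  open import Relation.Binary.Reasoning.Setoid R.setoid

  private
    I : ∀ {n} → Mat F n
    I = idM F

  sumF≡∑ : ∀ {n} (f : Fin n → Carrier) → sumF F f ≡ ∑ f
  sumF≡∑ {zero}  f = refl
  sumF≡∑ {suc n} f = cong (f fzero +F_) (sumF≡∑ (f ∘ fsuc))

  private
    viaSum : ∀ {n} (f g : Fin n → Carrier) → ∑ f ≈ ∑ g → sumF F f ≈ sumF F g
    viaSum f g = subst₂ _≈_ (sym (sumF≡∑ f)) (sym (sumF≡∑ g))

  sumF-cong : ∀ {n} (f g : Fin n → Carrier) → (∀ i → f i ≈ g i) → sumF F f ≈ sumF F g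
  sumF-cong f g f≈g = viaSum f g (sum-cong-≋ f≈g)

  sumF-permute : ∀ {n} (f : Fin n → Carrier) (π : Permutation′ n) → sumF F (f ∘ (π ⟨$⟩ʳ_)) ≈ sumF F f
  sumF-permute f π = viaSum (f ∘ (π ⟨$⟩ʳ_)) f (R.sym (∑-permute f π))

  sumF-+ : ∀ {n} (f g : Fin n → Carrier) → sumF F (λ i → f i +F g i) ≈ sumF F f +F sumF F g
  sumF-+ f g = subst₂ _≈_ (sym (sumF≡∑ (λ i → f i +F g i))) (sym (cong₂ _+F_ (sumF≡∑ f) (sumF≡∑ g)))
                 (∑-distrib-+ f g)

  sumF-zero : ∀ {n} (f : Fin n → Carrier) → (∀ i → f i ≈ 0#) → sumF F f ≈ 0#
  sumF-zero {n} f f≈0 = subst (_≈ 0#) (sym (sumF≡∑ f))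
                        (R.trans (sum-cong-≋ f≈0) (sum-replicate-zero n))

  sumF-single : ∀ {n} (f : Fin n → Carrier) i → (∀ l → l ≢ i → f l ≈ 0#) → sumF F f ≈ f i
  sumF-single {suc n} f i f≈0 = subst (_≈ f i) (sym (sumF≡∑ f)) (begin
    ∑ f                      ≈⟨ sum-remove f ⟩
    f i +F ∑ (f ∘ punchIn i) ≈⟨ R.+-congˡ (subst (_≈ 0#) (sumF≡∑ (f ∘ punchIn i))
                                  (sumF-zero _ (λ l → f≈0 (punchIn i l) (punchInᵢ≢i i l)))) ⟩
    f i +F 0#                ≈⟨ R.+-identityʳ (f i) ⟩
    f i                      ∎)

  I-diag : ∀ {n} (i : Fin n) → I i i ≡ 1#
  I-diag i with toℕ i ≡ᵇ toℕ i | ≡⇒≡ᵇ (toℕ i) (toℕ i) refl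
  ... | true | _ = refl

  I-offdiag : ∀ {n} {i j : Fin n} → i ≢ j → I i j ≡ 0#
  I-offdiag {i = i} {j} i≢j with toℕ i ≡ᵇ toℕ j in eq
  ... | false = refl
  ... | true  = contradiction (toℕ-injective (≡ᵇ⇒≡ _ _ (subst T (sym eq) tt))) i≢j

  I-permute : ∀ {n} (π : Permutation′ n) i j → I (π ⟨$⟩ʳ i) (π ⟨$⟩ʳ j) ≡ I i j
  I-permute π i j with i ≟ j
  ... | yes refl = trans (I-diag (π ⟨$⟩ʳ i)) (sym (I-diag i))
  ... | no i≢j   = trans (I-offdiag (i≢j ∘ injective)) (sym (I-offdiag i≢j))
    where
    injective : π ⟨$⟩ʳ i ≡ π ⟨$⟩ʳ j → i ≡ j
    injective e = trans (sym (inverseˡ π)) (trans (cong (π ⟨$⟩ˡ_) e) (inverseˡ π))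

  I-*ˡ : ∀ {n} (i : Fin n) (φ : Fin n → Carrier) → sumF F (λ l → I i l *F φ l) ≈ φ i
  I-*ˡ i φ = R.trans (sumF-single _ i (λ l l≢i → subst (λ z → z *F φ l ≈ 0#) (sym (I-offdiag (l≢i ∘ sym)))
                                                     (R.zeroˡ (φ l))))
                     (subst (λ z → z *F φ i ≈ φ i) (sym (I-diag i)) (R.*-identityˡ (φ i)))

  I-*ʳ : ∀ {n} (j : Fin n) (φ : Fin n → Carrier) → sumF F (λ l → φ l *F I l j) ≈ φ j
  I-*ʳ j φ = R.trans (sumF-single _ j (λ l l≢j → subst (λ z → φ l *F z ≈ 0#) (sym (I-offdiag l≢j))
                                                     (R.zeroʳ (φ l))))
                     (subst (λ z → φ j *F z ≈ φ j) (sym (I-diag j)) (R.*-identityʳ (φ j)))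

  IsGL-cong : ∀ {n} {g g′ : Mat F n} → _≈M_ F g g′ → IsGL F g → IsGL F g′
  IsGL-cong g≈g′ (h , gh≈I , hg≈I) = h ,
    (λ i j → R.trans (sumF-cong _ _ (λ l → R.*-congʳ (R.sym (g≈g′ i l)))) (gh≈I i j)) ,
    (λ i j → R.trans (sumF-cong _ _ (λ l → R.*-congˡ (R.sym (g≈g′ l j)))) (hg≈I i j))

  IsGL-permute : ∀ {n} (π : Permutation′ n) {g : Mat F n} → IsGL F g →
    IsGL F (λ i j → g (π ⟨$⟩ʳ i) (π ⟨$⟩ʳ j))
  IsGL-permute π {g} (h , gh≈I , hg≈I) = (λ i j → h (π ⟨$⟩ʳ i) (π ⟨$⟩ʳ j)) ,
    (λ i j → permuted i j (gh≈I (π ⟨$⟩ʳ i) (π ⟨$⟩ʳ j))) ,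
    (λ i j → permuted i j (hg≈I (π ⟨$⟩ʳ i) (π ⟨$⟩ʳ j)))
    where
    permuted : ∀ {f : Fin _ → Carrier} i j → sumF F f ≈ I (π ⟨$⟩ʳ i) (π ⟨$⟩ʳ j) →
               sumF F (f ∘ (π ⟨$⟩ʳ_)) ≈ I i j
    permuted {f} i j eq =
      R.trans (sumF-permute f π) (subst (sumF F f ≈_) (I-permute π i j) eq)

  transvection : ∀ {n} → Fin n → Fin n → Carrier → Mat F n
  transvection x y r i j = I i j +F (I i x *F r) *F I j y

  module _ {n} {x y : Fin n} (x≢y : x ≢ y) where

    private
      D : Carrier → Mat F n
      D r i j = (I i x *F r) *F I j y

      D-+ : ∀ r s i j → D r i j +F D s i j ≈ D (r +F s) i j
      D-+ r s i j = R.trans (R.sym (R.distribʳ (I j y) _ _)) (R.*-congʳ (R.sym (R.distribˡ (I i x) r s)))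

      D-nilpotent : ∀ r s i j l → D r i l *F D s l j ≈ 0#
      D-nilpotent r s i j l with l ≟ y
      ... | yes refl = R.trans (R.*-congˡ (subst (λ z → (z *F s) *F I j y ≈ 0#) (sym (I-offdiag (x≢y ∘ sym)))
                                                 (R.trans (R.*-congʳ (R.zeroˡ s)) (R.zeroˡ (I j y)))))
                               (R.zeroʳ (D r i l))
      ... | no l≢y   = R.trans (R.*-congʳ (subst (λ z → (I i x *F r) *F z ≈ 0#) (sym (I-offdiag l≢y))
                                                 (R.zeroʳ (I i x *F r))))
                               (R.zeroˡ (D s l j))

    transvection-* : ∀ r s →
      _≈M_ F (_*M_ F (transvection x y r) (transvection x y s)) (transvection x y (r +F s))
    transvection-* r s i j = begin
      sumF F (λ l → (I i l +F D r i l) *F (I l j +F D s l j))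
        ≈⟨ sumF-cong _ (λ l → (ii l +F is l) +F (ri l +F rs l))
             (λ l → R.trans (R.distribʳ _ _ _) (R.+-cong (R.distribˡ _ _ _) (R.distribˡ _ _ _))) ⟩
      sumF F (λ l → (ii l +F is l) +F (ri l +F rs l))
        ≈⟨ R.trans (sumF-+ (λ l → ii l +F is l) (λ l → ri l +F rs l))
                 (R.+-cong (sumF-+ ii is) (sumF-+ ri rs)) ⟩
      (sumF F (λ l → I i l *F I l j) +F sumF F (λ l → I i l *F D s l j)) +F
        (sumF F (λ l → D r i l *F I l j) +F sumF F (λ l → D r i l *F D s l j))
        ≈⟨ R.+-cong (R.+-cong (I-*ˡ i (λ l → I l j)) (I-*ˡ i (λ l → D s l j)))
                  (R.+-cong (I-*ʳ j (D r i)) (sumF-zero _ (D-nilpotent r s i j))) ⟩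
      (I i j +F D s i j) +F (D r i j +F 0#)
        ≈⟨ R.trans (R.+-assoc _ _ _) (R.+-congˡ (R.trans (R.+-congˡ (R.+-identityʳ _)) (R.+-comm _ _))) ⟩
      I i j +F (D r i j +F D s i j)
        ≈⟨ R.+-congˡ (D-+ r s i j) ⟩
      transvection x y (r +F s) i j ∎
      where
      ii is ri rs : Fin n → Carrier
      ii l = I i l *F I l j
      is l = I i l *F D s l j
      ri l = D r i l *F I l j
      rs l = D r i l *F D s l j

    transvection-0 : _≈M_ F (transvection x y 0#) I
    transvection-0 i j =
      R.trans (R.+-congˡ (R.trans (R.*-congʳ (R.zeroʳ (I i x))) (R.zeroˡ (I j y)))) (R.+-identityʳ (I i j))

    transvection-isGL : ∀ r → IsGL F (transvection x y r)
    transvection-isGL r = transvection x y (- r) ,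
      (λ i j → R.trans (transvection-* r (- r) i j)
                       (R.trans (at (R.-‿inverseʳ r) i j) (transvection-0 i j))) ,
      (λ i j → R.trans (transvection-* (- r) r i j)
                       (R.trans (at (R.-‿inverseˡ r) i j) (transvection-0 i j)))
      where
      at : ∀ {s t} → s ≈ t → ∀ i j → transvection x y s i j ≈ transvection x y t i j
      at s≈t i j = R.+-congˡ (R.*-congʳ (R.*-congˡ s≈t))

    transvection-xy : ∀ r → transvection x y r x y ≈ r
    transvection-xy r rewrite I-offdiag x≢y | I-diag x | I-diag y =
      R.trans (R.+-identityˡ _) (R.trans (R.*-identityʳ _) (R.*-identityˡ r))

    transvection-off : ∀ r i j → i ≢ j → ¬ (i ≡ x × j ≡ y) → transvection x y r i j ≈ 0#
    transvection-off r i j i≢j ¬xy rewrite I-offdiag i≢j with i ≟ x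
    ... | no i≢x   rewrite I-offdiag i≢x =
      R.trans (R.+-identityˡ _) (R.trans (R.*-congʳ (R.zeroˡ r)) (R.zeroˡ _))
    ... | yes refl rewrite I-offdiag (λ j≡y → ¬xy (refl , j≡y)) =
      R.trans (R.+-identityˡ _) (R.zeroʳ _)

  ≐G-trans : ∀ {n} {S S′ S″ : SubsetG F n} → _≐G_ F S S′ → _≐G_ F S′ S″ → _≐G_ F S S″
  ≐G-trans (S⊆S′ , S′⊆S) (S′⊆S″ , S″⊆S′) = (λ g → S′⊆S″ g ∘ S⊆S′ g) , (λ g → S′⊆S g ∘ S″⊆S′ g)

  ≐G-sym : ∀ {n} {S S′ : SubsetG F n} → _≐G_ F S S′ → _≐G_ F S′ S
  ≐G-sym (S⊆S′ , S′⊆S) = S′⊆S , S⊆S′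

  Parabolic : ∀ {n} → (Fin n → ℕ) → SubsetG F n
  Parabolic ℓ g = IsGL F g × (∀ x y → ℓ y < ℓ x → g x y ≈ 0#)

  module _ {n} {ℓ : Fin n → ℕ} where

    transvection∈Parabolic : ∀ {x y} (x≢y : x ≢ y) r → ℓ x ≤ ℓ y → Parabolic ℓ (transvection x y r)
    transvection∈Parabolic {x} {y} x≢y r ℓx≤ℓy = transvection-isGL x≢y r , λ i j ℓj<ℓi →
      transvection-off x≢y r i j (λ { refl → <-irrefl refl ℓj<ℓi })
                                 (λ { (refl , refl) → <⇒≱ ℓj<ℓi ℓx≤ℓy })

    transvection∈Parabolic⇒ : ∀ {x y} (x≢y : x ≢ y) → Parabolic ℓ (transvection x y 1#) → ℓ x ≤ ℓ y
    transvection∈Parabolic⇒ x≢y (_ , zeros) =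
      ≮⇒≥ λ ℓy<ℓx → R.1≉0 (R.trans (R.sym (transvection-xy x≢y 1#)) (zeros _ _ ℓy<ℓx))

  Parabolic-⊆⇒ : ∀ {n} {ℓ ℓ′ : Fin n → ℕ} → _⊆G_ F (Parabolic ℓ) (Parabolic ℓ′) →
    ∀ x y → ℓ x ≤ ℓ y → ℓ′ x ≤ ℓ′ y
  Parabolic-⊆⇒ ℓ⊆ℓ′ x y ℓx≤ℓy with x ≟ y
  ... | yes refl = ≤-refl
  ... | no x≢y   = transvection∈Parabolic⇒ x≢y (ℓ⊆ℓ′ _ (transvection∈Parabolic x≢y 1# ℓx≤ℓy))

  Parabolic-≗ : ∀ {n} {ℓ ℓ′ : Fin n → ℕ} → ℓ ≗ ℓ′ → _⊆G_ F (Parabolic ℓ) (Parabolic ℓ′)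
  Parabolic-≗ ℓ≗ℓ′ g (gl , zeros) = gl , λ x y ℓ′y<ℓ′x →
    zeros x y (subst₂ _<_ (sym (ℓ≗ℓ′ y)) (sym (ℓ≗ℓ′ x)) ℓ′y<ℓ′x)

  conj-Pα≐Parabolic : ∀ {k n} (α : Vec ℕ k) (σ : Permutation′ n) →
    _≐G_ F (conj F σ (Pα F α)) (Parabolic (blockLabel α σ))
  conj-Pα≐Parabolic α σ =
    (λ g (gl , zeros) →
       IsGL-cong (λ i j → R.reflexive (cong₂ g (inverseʳ σ) (inverseʳ σ))) (IsGL-permute (flip σ) gl) ,
       λ x y lt → subst₂ (λ u v → g u v ≈ 0#) (inverseʳ σ) (inverseʳ σ) (zeros _ _ lt)) ,
    (λ g (gl , zeros) →
       IsGL-permute σ gl ,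
       λ i j lt → zeros (σ ⟨$⟩ʳ i) (σ ⟨$⟩ʳ j)
                    (subst₂ _<_ (block (sym (inverseˡ σ))) (block (sym (inverseˡ σ))) lt))
    where
    block : ∀ {i j} → i ≡ j → blockOf α (toℕ i) ≡ blockOf α (toℕ j)
    block = cong (blockOf α ∘ toℕ)

  module _ {n} {ℓ : Fin n → ℕ} (a : ℕ) where

    P0H⊆Parabolic : MonotoneOnHalves a ℓ → _⊆G_ F (P0H F a) (Parabolic ℓ)
    P0H⊆Parabolic mono g (gl , upper , offdiagonal) = gl , zeros
      where
      zeros : ∀ x y → ℓ y < ℓ x → g x y ≈ 0#
      zeros x y ℓy<ℓx with toℕ y <? toℕ x
      ... | yes y<x = upper x y y<x
      ... | no y≮x with toℕ y <? a | toℕ x <? a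
      ...   | yes y<a | _       = contradiction (mono x y (≮⇒≥ y≮x) (inj₁ y<a)) (<⇒≱ ℓy<ℓx)
      ...   | no y≮a  | yes x<a = offdiagonal x y (inj₁ (x<a , ≮⇒≥ y≮a))
      ...   | no _    | no x≮a  = contradiction (mono x y (≮⇒≥ y≮x) (inj₂ (≮⇒≥ x≮a))) (<⇒≱ ℓy<ℓx)

    P0H⊆Parabolic⇒ : _⊆G_ F (P0H F a) (Parabolic ℓ) → MonotoneOnHalves a ℓ
    P0H⊆Parabolic⇒ P0H⊆ x y x≤y half with x ≟ y
    ... | yes refl = ≤-refl
    ... | no x≢y   = transvection∈Parabolic⇒ x≢y (P0H⊆ _ (transvection-isGL x≢y 1# , upper , offdiagonal))
      where
      x<y : toℕ x < toℕ y
      x<y = ≤∧≢⇒< x≤y (x≢y ∘ toℕ-injective)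
      upper : ∀ i j → toℕ j < toℕ i → transvection x y 1# i j ≈ 0#
      upper i j j<i = transvection-off x≢y 1# i j (λ { refl → <-irrefl refl j<i })
                                                  (λ { (refl , refl) → <-asym j<i x<y })
      offdiagonal : ∀ i j → (toℕ i < a × a ≤ toℕ j) ⊎ (a ≤ toℕ i × toℕ j < a) →
                    transvection x y 1# i j ≈ 0#
      offdiagonal i j (inj₁ (i<a , a≤j)) = transvection-off x≢y 1# i j
        (λ { refl → <-irrefl refl (<-≤-trans i<a a≤j) })
        (λ { (refl , refl) → [ (λ y<a → <-irrefl refl (<-≤-trans y<a a≤j)) ,
                               (λ a≤x → <-irrefl refl (<-≤-trans i<a a≤x)) ]′ half })
      offdiagonal i j (inj₂ (a≤i , j<a)) = transvection-off x≢y 1# i j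
        (λ { refl → <-irrefl refl (<-≤-trans j<a a≤i) })
        (λ { (refl , refl) → <-irrefl refl (<-≤-trans j<a (≤-trans a≤i x≤y)) })

module _ {c r} (F : Field c r) {k} (a b : ℕ) (α : Vec ℕ k) (sum-α : sum α ≡ a + b) where

  IsSigmaT⇒conj≐Parabolic : ∀ as bs σ (T : InT a b α as bs) → IsSigmaT a α as bs σ →
    (ℓ : Fin (a + b) → ℕ) → (∀ x → targetBlock a as bs (toℕ x) ≡ ℓ x) →
    _≐G_ F (conj F σ (Pα F α)) (Parabolic F ℓ)
  IsSigmaT⇒conj≐Parabolic as bs σ T S ℓ realises =
    ≐G-trans F (conj-Pα≐Parabolic F α σ) (Parabolic-≗ F labels , Parabolic-≗ F (sym ∘ labels))
    where
    labels : ∀ x → blockLabel α σ x ≡ ℓ x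
    labels x = trans (SigmaT.IsSigmaT⇒blockLabel a b α as bs sum-α T σ S x) (realises x)

  IsSigmaT⇒P0H⊆conj : ∀ as bs σ → InT a b α as bs → IsSigmaT a α as bs σ →
    _⊆G_ F (P0H F a) (conj F σ (Pα F α))
  IsSigmaT⇒P0H⊆conj as bs σ T S g g∈P0H =
    proj₂ (IsSigmaT⇒conj≐Parabolic as bs σ T S (targetBlock a as bs ∘ toℕ) (λ _ → refl)) g
      (P0H⊆Parabolic F a (λ x y → targetBlock-mono a as bs) g g∈P0H)

  module _ (positive : ∀ j → 0 < lookup α j) where

    conj-Pα-injective : ∀ as bs as′ bs′ σ σ′ →
      InT a b α as bs → IsSigmaT a α as bs σ → InT a b α as′ bs′ → IsSigmaT a α as′ bs′ σ′ →
      _≐G_ F (conj F σ (Pα F α)) (conj F σ′ (Pα F α)) → as ≡ as′ × bs ≡ bs′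
    conj-Pα-injective as bs as′ bs′ σ σ′ T S T′ S′ σP≐σ′P =
      targetBlock-injective a as bs as′ bs′ (proj₁ T) (proj₁ (proj₂ T)) (proj₁ T′) (proj₁ (proj₂ T′))
        same-target
      where
      Pσ≐Pσ′ : _≐G_ F (Parabolic F (blockLabel α σ)) (Parabolic F (blockLabel α σ′))
      Pσ≐Pσ′ = ≐G-trans F (≐G-sym F (conj-Pα≐Parabolic F α σ))
                          (≐G-trans F σP≐σ′P (conj-Pα≐Parabolic F α σ′))
      same-label : ∀ x → blockLabel α σ x ≡ blockLabel α σ′ x
      same-label = labelling-unique (blockLabel α σ) (blockLabel α σ′)
        (blockLabel-downClosed α σ sum-α positive) (blockLabel-downClosed α σ′ sum-α positive)
        (Parabolic-⊆⇒ F (proj₁ Pσ≐Pσ′)) (Parabolic-⊆⇒ F (proj₂ Pσ≐Pσ′))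
      same-target : ∀ {y} → y < a + b → targetBlock a as bs y ≡ targetBlock a as′ bs′ y
      same-target y<n = subst (λ y → targetBlock a as bs y ≡ targetBlock a as′ bs′ y) (toℕ-fromℕ< y<n)
        (trans (sym (label-σ (fromℕ< y<n))) (trans (same-label (fromℕ< y<n)) (label-σ′ (fromℕ< y<n))))
        where
        label-σ = SigmaT.IsSigmaT⇒blockLabel a b α as bs sum-α T σ S
        label-σ′ = SigmaT.IsSigmaT⇒blockLabel a b α as′ bs′ sum-α T′ σ′ S′

    InF⇒σT : (Q : SubsetG F (a + b)) → InF F a α Q →
      Σ (Vec ℕ k) λ as → Σ (Vec ℕ k) λ bs → Σ (Permutation′ (a + b)) λ σ →
        InT a b α as bs × IsSigmaT a α as bs σ × _≐G_ F (conj F σ (Pα F α)) Q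
    InF⇒σT Q ((σ , Q≐σP) , P0H⊆Q) =
      let as , bs , T , realises = targetBlock-surjective α a b (extendℕ label)
            (MonotoneOnHalves⇒lower a monotone) (MonotoneOnHalves⇒upper a monotone)
            (extendℕ-blockLabel< α σ sum-α) (count-blockLabel α σ sum-α)
          open SigmaT a b α as bs sum-α T
      in as , bs , σT , T , σT-isSigmaT ,
         ≐G-trans F (IsSigmaT⇒conj≐Parabolic as bs σT T σT-isSigmaT label
                       (λ x → trans (realises (toℕ<n x)) (extendℕ-toℕ label x)))
                    (≐G-sym F (≐G-trans F Q≐σP (conj-Pα≐Parabolic F α σ)))
      where
      label = blockLabel α σ
      monotone : MonotoneOnHalves a label
      monotone = P0H⊆Parabolic⇒ F a λ g g∈P0H →
        proj₁ (conj-Pα≐Parabolic F α σ) g (proj₁ Q≐σP g (P0H⊆Q g g∈P0H))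

lemma7p4 : ∀ {c ℓ : Level} (F : Field c ℓ) (a b k : ℕ) (α : Vec ℕ k) →
    IsComposition (a + b) α →
    ((as bs : Vec ℕ k) → InT a b α as bs →
      Σ (Permutation′ (a + b)) λ σ → IsSigmaT a α as bs σ)
    × ((as bs : Vec ℕ k) (σ : Permutation′ (a + b)) → InT a b α as bs →
      IsSigmaT a α as bs σ → InF F a α (conj F σ (Pα F α)))
    × ((as bs as′ bs′ : Vec ℕ k) (σ σ′ : Permutation′ (a + b)) →
      InT a b α as bs → IsSigmaT a α as bs σ →
      InT a b α as′ bs′ → IsSigmaT a α as′ bs′ σ′ →
      _≐G_ F (conj F σ (Pα F α)) (conj F σ′ (Pα F α)) →
      (as ≡ as′ × bs ≡ bs′))
    × ((Q : SubsetG F (a + b)) → InF F a α Q →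
      Σ (Vec ℕ k) λ as → Σ (Vec ℕ k) λ bs → Σ (Permutation′ (a + b)) λ σ →
        InT a b α as bs × IsSigmaT a α as bs σ × _≐G_ F (conj F σ (Pα F α)) Q)
lemma7p4 F a b k α (sum-α , positive) =
  (λ as bs T → σT a b α as bs sum-α T , σT-isSigmaT a b α as bs sum-α T) ,
  (λ as bs σ T S → (σ , (λ _ → id) , (λ _ → id)) , IsSigmaT⇒P0H⊆conj F a b α sum-α as bs σ T S) ,
  conj-Pα-injective F a b α sum-α positive ,
  InF⇒σT F a b α sum-α positive
  where open SigmaT using (σT; σT-isSigmaT)
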